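{- For any graph $H$, \[\operatorname{cfan}(H)=\max_K\min\{\operatorname{cdeg}_{H,K}(x,y): xy\in E(K)\},\] where the maximum is taken over all subgraphs $K\subseteq H$ with $E(K)\neq\emptyset$ that have full multiplicity.
   Context: A graph may have parallel edges but no loops. For a graph $J$, $\mu_J(x,y)$ is the number of edges of $J$ joining $x$ and $y$; $d_J(v)$ is the degree of $v$ counting parallel edges; $N_J(x)$ is the neighbourhood of $x$. A subgraph may contain only some of the parallel copies of an edge. A subgraph $K\subseteq H$ has full multiplicity if $\mu_K(e)=\mu_H(e)$ for every edge $e\in E(K)$ (some edges of $H$ may be omitted entirely). For a subgraph $K\subseteq H$ and an ordered pair $(x,y)$ with $xy\in E(K)$, $\operatorname{cdeg}_{H,K}(x,y)$ is the smallest nonnegative integer $l$ such that for all $Z\subseteq N_K(x)$ with $y\in Z$, $\sum_{z\in Z}(d_K(z)-d_H(z)+\mu_K(x,z)-l)\leq 1$; $\operatorname{cfan}(H)=\max_{K\subseteq H,\,E(K)\neq\emptyset}\min\{\operatorname{cdeg}_{H,K}(x,y): xy\in E(K)\}$, with $\operatorname{cfan}(H)=0$ if $H$ is edgeless. -}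

module Defs where

open import Data.Nat as ℕ using (ℕ; zero; suc; _<_)
open import Data.Integer as ℤ using (ℤ; +_; _-_)
open import Data.Fin using (Fin; zero; suc)
open import Data.Fin.Subset using (Subset; _∈_)
open import Data.Vec using (lookup)
open import Data.Bool using (if_then_else_)
open import Data.Product using (Σ; _×_; ∃)
open import Data.Sum using (_⊎_)
open import Data.Unit using (⊤)
open import Data.Empty using (⊥)
open import Relation.Binary.PropositionalEquality using (_≡_)

sumℕ : ∀ {n} → (Fin n → ℕ) → ℕ
sumℕ {zero}  f = 0
sumℕ {suc n} f = f zero ℕ.+ sumℕ (λ i → f (suc i))

sumℤ : ∀ {n} → (Fin n → ℤ) → ℤ
sumℤ {zero}  f = + 0
sumℤ {suc n} f = f zero ℤ.+ sumℤ (λ i → f (suc i))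

record Graph (n : ℕ) : Set where
  field
    μ        : Fin n → Fin n → ℕ
    sym      : ∀ x y → μ x y ≡ μ y x
    loopless : ∀ x → μ x x ≡ 0
open Graph public

deg : ∀ {n} → (Fin n → Fin n → ℕ) → Fin n → ℕ
deg m v = sumℕ (λ u → m v u)

-- A subgraph K ⊆ H (only its edge multiset matters): a symmetric
-- multiplicity function bounded by that of H (possibly only some
-- parallel copies of an edge).
record Subgraph {n : ℕ} (H : Graph n) : Set where
  field
    κ     : Fin n → Fin n → ℕ
    κsym  : ∀ x y → κ x y ≡ κ y x
    κ≤μ   : ∀ x y → κ x y ℕ.≤ μ H x y
open Subgraph public

IsEdge : ∀ {n} {H : Graph n} → Subgraph H → Fin n → Fin n → Set
IsEdge K x y = 0 < κ K x y

NonEmpty : ∀ {n} {H : Graph n} → Subgraph H → Set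
NonEmpty K = Σ _ λ x → Σ _ λ y → IsEdge K x y

Edgeless : ∀ {n} → Graph n → Set
Edgeless H = ∀ x y → μ H x y ≡ 0

FullMult : ∀ {n} {H : Graph n} → Subgraph H → Set
FullMult {H = H} K = ∀ x y → 0 < κ K x y → κ K x y ≡ μ H x y

cdegSum : ∀ {n} (H : Graph n) (K : Subgraph H) → Fin n → Subset n → ℕ → ℤ
cdegSum H K x Z l =
  sumℤ (λ z → if lookup Z z
              then (+ deg (κ K) z) - (+ deg (μ H) z) ℤ.+ (+ κ K x z) - (+ l)
              else + 0)

CdegOK : ∀ {n} (H : Graph n) (K : Subgraph H) → Fin n → Fin n → ℕ → Set
CdegOK {n} H K x y l =
  ∀ (Z : Subset n) → (∀ z → z ∈ Z → IsEdge K x z) → y ∈ Z →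
    cdegSum H K x Z l ℤ.≤ + 1

IsCdeg : ∀ {n} (H : Graph n) (K : Subgraph H) → Fin n → Fin n → ℕ → Set
IsCdeg H K x y c = CdegOK H K x y c × (∀ l → CdegOK H K x y l → c ℕ.≤ l)

IsMinCdeg : ∀ {n} (H : Graph n) (K : Subgraph H) → ℕ → Set
IsMinCdeg H K m =
  (Σ _ λ x → Σ _ λ y → IsEdge K x y × IsCdeg H K x y m)
  × (∀ x y → IsEdge K x y → ∀ c → IsCdeg H K x y c → m ℕ.≤ c)

-- c = max over subgraphs K ⊆ H with E(K) ≠ ∅ satisfying P of
-- min { cdeg_{H,K}(x,y) : xy ∈ E(K) }, with value 0 if H is edgeless.
IsMaxMinCdeg : ∀ {n} (H : Graph n) → (Subgraph H → Set) → ℕ → Set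
IsMaxMinCdeg H P c =
  ((Σ (Subgraph H) λ K → P K × NonEmpty K × IsMinCdeg H K c)
     ⊎ (Edgeless H × c ≡ 0))
  × (∀ K → P K → NonEmpty K → ∀ m → IsMinCdeg H K m → m ℕ.≤ c)

IsCfan : ∀ {n} → Graph n → ℕ → Set
IsCfan H c = IsMaxMinCdeg H (λ _ → ⊤) c

-- Replacing each edge of K by all of its parallel copies in H gives a
-- full-multiplicity subgraph K⁺ with the same edge set.  This can only raise
-- d_K(z) and μ_K(x,z), hence every sum in the definition of cdeg, so
-- cdeg_{H,K}(x,y) ≤ cdeg_{H,K⁺}(x,y) on every edge and the minimum over the
-- edges does not drop: the maximum defining cfan is attained at a subgraph of
-- full multiplicity.  All these extrema exist because l = d_K(x) always
-- satisfies the cdeg condition and the condition is decidable.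
module Submission where

open import Defs
open import Data.Nat using (ℕ; zero; suc; z≤n; s≤s; _≤_; _<_; _≤?_; _≟_)
open import Function.Bundles using (_⇔_; mk⇔)

import Data.Nat.Properties as ℕₚ
open import Data.Integer as ℤ using (ℤ; +_; _-_; +≤+)
import Data.Integer.Properties as ℤₚ
open import Data.Fin using (Fin; zero; suc)
open import Data.Fin.Subset using (Subset; _∈_)
open import Data.Fin.Subset.Properties using (_∈?_; anySubset?)
open import Data.Fin.Properties using (any?; all?)
open import Data.Vec using ([]; _∷_; lookup)
open import Data.Bool using (true; false; if_then_else_)
open import Data.Product using (Σ; _×_; ∃; _,_; proj₁; proj₂)
open import Data.Sum using (_⊎_; inj₁; inj₂)
open import Data.Unit using (⊤; tt)
open import Data.Empty using (⊥-elim)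
open import Function.Base using (_∘_)
open import Relation.Nullary using (Dec; yes; no; ¬_)
open import Relation.Nullary.Decidable using (_×-dec_; _→-dec_; ¬?; decidable-stable)
open import Relation.Binary.PropositionalEquality using (_≡_; refl; cong₂; subst)

Least : (ℕ → Set) → ℕ → Set
Least P c = P c × (∀ l → P l → c ≤ l)

Least-unique : ∀ {P c c′} → Least P c → Least P c′ → c ≡ c′
Least-unique (pc , c-min) (pc′ , c′-min) = ℕₚ.≤-antisym (c-min _ pc′) (c′-min _ pc)

module _ {P : ℕ → Set} (P? : ∀ k → Dec (P k)) where

  least-or-none : ∀ b → ∃ (Least P) ⊎ (∀ l → l < b → ¬ P l)
  least-or-none zero = inj₂ (λ _ ())
  least-or-none (suc b) with least-or-none b | P? b
  ... | inj₁ least | _      = inj₁ least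
  ... | inj₂ none  | yes pb = inj₁ (b , pb , λ l pl → ℕₚ.≮⇒≥ (λ l<b → none l l<b pl))
  ... | inj₂ none  | no ¬pb = inj₂ below
    where
    below : ∀ l → l < suc b → ¬ P l
    below l l<1+b with ℕₚ.m<1+n⇒m<n∨m≡n l<1+b
    ... | inj₁ l<b  = none l l<b
    ... | inj₂ refl = ¬pb

  least-exists : ∀ {b} → P b → ∃ (Least P)
  least-exists {b} pb with least-or-none (suc b)
  ... | inj₁ least = least
  ... | inj₂ none  = ⊥-elim (none b ℕₚ.≤-refl pb)

allSubset? : ∀ {n} {P : Subset n → Set} → (∀ Z → Dec (P Z)) → Dec (∀ Z → P Z)
allSubset? P? with anySubset? (¬? ∘ P?)
... | yes (Z , ¬pZ) = no (λ all → ¬pZ (all Z))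
... | no none       = yes (λ Z → decidable-stable (P? Z) (λ ¬pZ → none (Z , ¬pZ)))

sumℕ-mono : ∀ {n} {f g : Fin n → ℕ} → (∀ i → f i ≤ g i) → sumℕ f ≤ sumℕ g
sumℕ-mono {zero}  f≤g = z≤n
sumℕ-mono {suc n} f≤g = ℕₚ.+-mono-≤ (f≤g zero) (sumℕ-mono (f≤g ∘ suc))

≤-sumℕ : ∀ {n} (f : Fin n → ℕ) i → f i ≤ sumℕ f
≤-sumℕ f zero    = ℕₚ.m≤m+n _ _
≤-sumℕ f (suc i) = ℕₚ.≤-trans (≤-sumℕ (f ∘ suc) i) (ℕₚ.m≤n+m _ (f zero))

sumOver : ∀ {n} → Subset n → (Fin n → ℤ) → ℤ
sumOver Z f = sumℤ (λ z → if lookup Z z then f z else + 0)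

sumOver-mono : ∀ {n} (Z : Subset n) {f g : Fin n → ℤ} →
               (∀ z → f z ℤ.≤ g z) → sumOver Z f ℤ.≤ sumOver Z g
sumOver-mono []          f≤g = ℤₚ.≤-refl
sumOver-mono (true ∷ Z)  f≤g = ℤₚ.+-mono-≤ (f≤g zero) (sumOver-mono Z (f≤g ∘ suc))
sumOver-mono (false ∷ Z) f≤g = ℤₚ.+-monoʳ-≤ (+ 0) (sumOver-mono Z (f≤g ∘ suc))

sumOver-nonpos : ∀ {n} (Z : Subset n) {f : Fin n → ℤ} →
                 (∀ z → f z ℤ.≤ + 0) → sumOver Z f ℤ.≤ + 0
sumOver-nonpos []          f≤0 = ℤₚ.≤-refl
sumOver-nonpos (true ∷ Z)  f≤0 = ℤₚ.+-mono-≤ (f≤0 zero) (sumOver-nonpos Z (f≤0 ∘ suc))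
sumOver-nonpos (false ∷ Z) f≤0 = ℤₚ.+-monoʳ-≤ (+ 0) (sumOver-nonpos Z (f≤0 ∘ suc))

sub-add-sub-mono : ∀ {a a′ c c′} b l → a ℤ.≤ a′ → c ℤ.≤ c′ →
                   a - b ℤ.+ c - l ℤ.≤ a′ - b ℤ.+ c′ - l
sub-add-sub-mono b l a≤a′ c≤c′ =
  ℤₚ.+-monoˡ-≤ (ℤ.- l) (ℤₚ.+-mono-≤ (ℤₚ.+-monoˡ-≤ (ℤ.- b) a≤a′) c≤c′)

sub-add-sub-nonpos : ∀ {a b c l} → a ℤ.≤ b → c ℤ.≤ l → a - b ℤ.+ c - l ℤ.≤ + 0
sub-add-sub-nonpos {a} {b} {c} {l} a≤b c≤l =
  ℤₚ.≤-trans (ℤₚ.≤-reflexive (ℤₚ.+-assoc (a - b) c (ℤ.- l)))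
             (ℤₚ.+-mono-≤ (ℤₚ.i≤j⇒i-j≤0 a≤b) (ℤₚ.i≤j⇒i-j≤0 c≤l))

module _ {n} {H : Graph n} where

  infix 4 _⊑_
  record _⊑_ (K K′ : Subgraph H) : Set where
    constructor mk⊑
    field κ-mono : ∀ x y → κ K x y ≤ κ K′ x y
  open _⊑_

  IsEdge-mono : ∀ {K K′ x y} → K ⊑ K′ → IsEdge K x y → IsEdge K′ x y
  IsEdge-mono {x = x} {y} K⊑K′ xy = ℕₚ.<-≤-trans xy (κ-mono K⊑K′ x y)

  NonEmpty-mono : ∀ {K K′} → K ⊑ K′ → NonEmpty K → NonEmpty K′
  NonEmpty-mono K⊑K′ (x , y , xy) = x , y , IsEdge-mono K⊑K′ xy

  cdegSum-mono : ∀ {K K′} → K ⊑ K′ → ∀ x Z l → cdegSum H K x Z l ℤ.≤ cdegSum H K′ x Z l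
  cdegSum-mono K⊑K′ x Z l = sumOver-mono Z (λ z →
    sub-add-sub-mono (+ deg (μ H) z) (+ l)
      (+≤+ (sumℕ-mono (κ-mono K⊑K′ z))) (+≤+ (κ-mono K⊑K′ x z)))

  CdegOK-antitone : ∀ {K K′ x y l} → K ⊑ K′ → CdegOK H K′ x y l → CdegOK H K x y l
  CdegOK-antitone {x = x} {l = l} K⊑K′ ok Z Z⊆N y∈Z =
    ℤₚ.≤-trans (cdegSum-mono K⊑K′ x Z l)
               (ok Z (λ z z∈Z → IsEdge-mono K⊑K′ (Z⊆N z z∈Z)) y∈Z)

  cdeg-mono : ∀ {K K′ x y c c′} → K ⊑ K′ → IsCdeg H K x y c → IsCdeg H K′ x y c′ → c ≤ c′
  cdeg-mono K⊑K′ (_ , c-min) (ok′ , _) = c-min _ (CdegOK-antitone K⊑K′ ok′)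

module _ {n} {H : Graph n} (K : Subgraph H) where

  CdegOK-degree : ∀ x y → CdegOK H K x y (deg (κ K) x)
  CdegOK-degree x y Z _ _ = ℤₚ.≤-trans (sumOver-nonpos Z (λ z →
    sub-add-sub-nonpos (+≤+ (sumℕ-mono (κ≤μ K z))) (+≤+ (≤-sumℕ (κ K x) z))))
    (+≤+ z≤n)

  CdegOK? : ∀ x y l → Dec (CdegOK H K x y l)
  CdegOK? x y l = allSubset? (λ Z →
    all? (λ z → (z ∈? Z) →-dec (1 ≤? κ K x z))
      →-dec ((y ∈? Z) →-dec (cdegSum H K x Z l ℤ.≤? + 1)))

  cdeg-exists : ∀ x y → ∃ (IsCdeg H K x y)
  cdeg-exists x y = least-exists (CdegOK? x y) (CdegOK-degree x y)

  cdeg : Fin n → Fin n → ℕ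
  cdeg x y = proj₁ (cdeg-exists x y)

  IsCdeg-cdeg : ∀ x y → IsCdeg H K x y (cdeg x y)
  IsCdeg-cdeg x y = proj₂ (cdeg-exists x y)

  AttainedOnEdge : ℕ → Set
  AttainedOnEdge m = ∃ λ x → ∃ λ y → IsEdge K x y × m ≡ cdeg x y

  AttainedOnEdge? : ∀ m → Dec (AttainedOnEdge m)
  AttainedOnEdge? m = any? (λ x → any? (λ y → (1 ≤? κ K x y) ×-dec (m ≟ cdeg x y)))

  minCdeg-exists : NonEmpty K → ∃ (IsMinCdeg H K)
  minCdeg-exists (x , y , xy) with least-exists AttainedOnEdge? (x , y , xy , refl)
  ... | m , (x′ , y′ , x′y′ , refl) , m-min =
    m , (x′ , y′ , x′y′ , IsCdeg-cdeg x′ y′) ,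
    λ a b ab c isc → m-min c (a , b , ab , Least-unique isc (IsCdeg-cdeg a b))

minCdeg-mono : ∀ {n} {H : Graph n} {K K′ : Subgraph H} {m m′} → K ⊑ K′ →
               (∀ x y → IsEdge K′ x y → IsEdge K x y) →
               IsMinCdeg H K m → IsMinCdeg H K′ m′ → m ≤ m′
minCdeg-mono {K = K} K⊑K′ K′⊆K (_ , m-min) ((x , y , xy , isc′) , _) =
  ℕₚ.≤-trans (m-min x y (K′⊆K x y xy) _ (IsCdeg-cdeg K x y))
             (cdeg-mono K⊑K′ (IsCdeg-cdeg K x y) isc′)

fillIfPositive : ℕ → ℕ → ℕ
fillIfPositive zero    _ = 0
fillIfPositive (suc _) m = m

module _ {n} {H : Graph n} (K : Subgraph H) where

  saturate : Subgraph H
  saturate = record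
    { κ    = λ x y → fillIfPositive (κ K x y) (μ H x y)
    ; κsym = λ x y → cong₂ fillIfPositive (κsym K x y) (Graph.sym H x y)
    ; κ≤μ  = λ x y → κ≤μ-saturate (κ K x y)
    }
    where
    κ≤μ-saturate : ∀ {m} k → fillIfPositive k m ≤ m
    κ≤μ-saturate zero    = z≤n
    κ≤μ-saturate (suc _) = ℕₚ.≤-refl

  saturate-full : FullMult saturate
  saturate-full x y _ with κ K x y
  ... | suc _ = refl

  ⊑-saturate : K ⊑ saturate
  ⊑-saturate = mk⊑ κ-le
    where
    κ-le : ∀ x y → κ K x y ≤ κ saturate x y
    κ-le x y with κ K x y | κ≤μ K x y
    ... | zero  | _   = z≤n
    ... | suc _ | k≤m = k≤m

  saturate-edge : ∀ x y → IsEdge saturate x y → IsEdge K x y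
  saturate-edge x y xy with κ K x y
  ... | suc _ = s≤s z≤n

module _ {n} (H : Graph n) where

  MaxMinAttained : (Subgraph H → Set) → ℕ → Set
  MaxMinAttained P c =
    (Σ (Subgraph H) λ K → P K × NonEmpty K × IsMinCdeg H K c) ⊎ (Edgeless H × c ≡ 0)

  maxMinCdeg-cofinal :
    ∀ {P Q : Subgraph H → Set} {c} → (∀ {K} → Q K → P K) →
    (∀ {K} → P K → NonEmpty K →
       ∃ λ K′ → Q K′ × NonEmpty K′ ×
         (∀ {m m′} → IsMinCdeg H K m → IsMinCdeg H K′ m′ → m ≤ m′)) →
    IsMaxMinCdeg H P c ⇔ IsMaxMinCdeg H Q c
  maxMinCdeg-cofinal {P} {Q} {c} Q⇒P cofinal = mk⇔ to from
    where
    to : IsMaxMinCdeg H P c → IsMaxMinCdeg H Q c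
    to (attained , c-max) = attainedQ attained , λ K → c-max K ∘ Q⇒P
      where
      attainedQ : MaxMinAttained P c → MaxMinAttained Q c
      attainedQ (inj₂ edgeless) = inj₂ edgeless
      attainedQ (inj₁ (K , pK , ne , min-c)) with cofinal pK ne
      ... | K′ , qK′ , ne′ , K≤K′ with minCdeg-exists K′ ne′
      ... | m′ , min-m′ =
        inj₁ (K′ , qK′ , ne′ ,
              subst (IsMinCdeg H K′)
                    (ℕₚ.≤-antisym (c-max K′ (Q⇒P qK′) ne′ m′ min-m′) (K≤K′ min-c min-m′))
                    min-m′)

    from : IsMaxMinCdeg H Q c → IsMaxMinCdeg H P c
    from (attained , c-max) = attainedP attained , c-maxP
      where
      attainedP : MaxMinAttained Q c → MaxMinAttained P c
      attainedP (inj₁ (K , qK , rest)) = inj₁ (K , Q⇒P qK , rest)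
      attainedP (inj₂ edgeless)        = inj₂ edgeless

      c-maxP : ∀ K → P K → NonEmpty K → ∀ m → IsMinCdeg H K m → m ≤ c
      c-maxP K pK ne m min-m with cofinal pK ne
      ... | K′ , qK′ , ne′ , K≤K′ with minCdeg-exists K′ ne′
      ... | m′ , min-m′ = ℕₚ.≤-trans (K≤K′ min-m min-m′) (c-max K′ qK′ ne′ m′ min-m′)

lemma3p3 : ∀ {n} (H : Graph n) (c : ℕ) →
    IsCfan H c ⇔ IsMaxMinCdeg H FullMult c
lemma3p3 H c = maxMinCdeg-cofinal H {P = λ _ → ⊤} {Q = FullMult} (λ _ → tt)
  (λ {K} _ ne → saturate K , saturate-full K , NonEmpty-mono (⊑-saturate K) ne ,
                minCdeg-mono (⊑-saturate K) (saturate-edge K))
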